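{- Let $s\ge 1$ be an integer and let $\mathbf{A}_1,\dots,\mathbf{A}_s\in\mathbb{C}^{2\times 2}$ with $\mathbf{A}_t=\begin{pmatrix}\alpha_{1,1}^{(t)}&\alpha_{1,2}^{(t)}\\ \alpha_{2,1}^{(t)}&\alpha_{2,2}^{(t)}\end{pmatrix}$. Let $(a_n)_{n\ge0}$, $(b_n)_{n\ge0}$ be complex sequences with arbitrary initial values $a_0,\dots,a_{s-1},b_0,\dots,b_{s-1}$, satisfying for all $n\ge s$ \[ \begin{pmatrix}a_n\\ b_n\end{pmatrix}=\sum_{t=1}^{s}\mathbf{A}_t\begin{pmatrix}a_{n-t}\\ b_{n-t}\end{pmatrix}, \] i.e. $a_n=\sum_{t=1}^s(\alpha_{1,1}^{(t)}a_{n-t}+\alpha_{1,2}^{(t)}b_{n-t})$ and $b_n=\sum_{t=1}^s(\alpha_{2,1}^{(t)}a_{n-t}+\alpha_{2,2}^{(t)}b_{n-t})$. Define vectors $\mathbf{c}^{(r)}=(c^{(r)}_1,\dots,c^{(r)}_{2r})^T\in\mathbb{C}^{2r}$ for $r=1,\dots,s$ recursively by \[ \mathbf{c}^{(1)}=\begin{pmatrix}\operatorname{tr}(\mathbf{A}_1)\\ -|\mathbf{A}_1|\end{pmatrix}, \] and, for $2\le r\le s$, \[ \mathbf{c}^{(r)}= \begin{pmatrix}\mathbf{c}^{(r-1)}\\0\\0\end{pmatrix}+ \begin{pmatrix} 0\\ \vdots\\ 0\\ \operatorname{tr}(\mathbf{A}_{r})\\ -\mathcal{D}(\mathbf{A}^{(1,r)})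 \\ \vdots\\ -\mathcal{D}(\mathbf{A}^{(r-1,r)}) \\ 0 \end{pmatrix}+ \begin{pmatrix} 0\\ \vdots\\ 0 \\ -|\mathbf{A}_{r}| \end{pmatrix}, \] where in the second vector the entry $\operatorname{tr}(\mathbf{A}_r)$ is in position $r$, the entry $-\mathcal{D}(\mathbf{A}^{(\ell,r)})$ is in position $r+\ell$ for $\ell=1,\dots,r-1$, and all other entries (including position $2r$) are $0$; and in the third vector the only nonzero entry is $-|\mathbf{A}_r|$ in position $2r$. Equivalently, $c^{(r)}_i=c^{(r-1)}_i+\delta_{i,r}\operatorname{tr}(\mathbf{A}_r)-\sum_{\ell=1}^{r-1}\delta_{i,r+\ell}\,\mathcal{D}(\mathbf{A}^{(\ell,r)})-\delta_{i,2r}|\mathbf{A}_r|$ for $1\le i\le 2r$, with the convention $c^{(r-1)}_{2r-1}=c^{(r-1)}_{2r}=0$. Then both sequences $(a_n)$ and $(b_n)$ satisfy the homogeneous linear recurrence of order $2s$ \[ z_n=\sum_{i=1}^{2s}c^{(s)}_i z_{n-i},\qquad n\ge 2s. \]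
   Context: For a $2\times2$ matrix $\mathbf{A}$, $|\mathbf{A}|$ denotes its determinant and $\operatorname{tr}(\mathbf{A})$ its trace. For $1\le i,j\le s$, $\mathbf{A}_{i,j}$ denotes the $2\times 2$ matrix whose first column is the first column of $\mathbf{A}_i$ and whose second column is the second column of $\mathbf{A}_j$, i.e. $\mathbf{A}_{i,j}=\begin{pmatrix}\alpha_{1,1}^{(i)}&\alpha_{1,2}^{(j)}\\ \alpha_{2,1}^{(i)}&\alpha_{2,2}^{(j)}\end{pmatrix}$, and $\mathcal{D}(\mathbf{A}^{(i,j)}):=|\mathbf{A}_{i,j}|+|\mathbf{A}_{j,i}|$ (so $\mathcal{D}(\mathbf{A}^{(i,j)})=\mathcal{D}(\mathbf{A}^{(j,i)})$ and $\mathcal{D}(\mathbf{A}^{(i,i)})=2|\mathbf{A}_i|$). Note that $\mathbf{c}^{(r)}$ depends only on $\mathbf{A}_1,\dots,\mathbf{A}_r$. -}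

module Defs where

open import Level using (Level)
open import Algebra.Bundles using (CommutativeRing)
open import Data.Nat using (ℕ; zero; suc; _≟_)
open import Relation.Nullary using (yes; no)

-- All definitions are over an arbitrary commutative ring R (stand-in for ℂ).
module _ {c ℓ : Level} (R : CommutativeRing c ℓ) where
  open CommutativeRing R

  record Mat2 : Set c where
    constructor mat2
    field
      m11 m12 m21 m22 : Carrier
  open Mat2 public

  sub : Carrier → Carrier → Carrier
  sub x y = x + (- y)

  Σ1 : ℕ → (ℕ → Carrier) → Carrier
  Σ1 zero    f = 0#
  Σ1 (suc m) f = Σ1 m f + f (suc m)

  δ : ℕ → ℕ → Carrier → Carrier
  δ i j x with i ≟ j
  ... | yes _ = x
  ... | no  _ = 0#

  tr : Mat2 → Carrier
  tr M = m11 M + m22 M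

  det : Mat2 → Carrier
  det M = sub (m11 M * m22 M) (m12 M * m21 M)

  -- A_{i,j}: first column of A_i, second column of A_j
  mixCol : Mat2 → Mat2 → Mat2
  mixCol Ai Aj = mat2 (m11 Ai) (m12 Aj) (m21 Ai) (m22 Aj)

  𝒟 : (ℕ → Mat2) → ℕ → ℕ → Carrier
  𝒟 A i j = det (mixCol (A i) (A j)) + det (mixCol (A j) (A i))

  -- coef A r i = c^{(r)}_i  (matrices A_t = A t for t ≥ 1; index 0 unused).
  -- c^{(0)} := 0, which makes the recursive step at r = 1 produce exactly
  -- c^{(1)} = (tr A_1, -|A_1|).
  coef : (ℕ → Mat2) → ℕ → ℕ → Carrier
  coef A zero    i = 0#
  coef A (suc r) i =
    sub (sub (coef A r i + δ i (suc r) (tr (A (suc r))))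
             (Σ1 r (λ l → δ i (suc r Data.Nat.+ l) (𝒟 A l (suc r)))))
        (δ i (suc r Data.Nat.+ suc r) (det (A (suc r))))

{-# OPTIONS --safe #-}
module Submission where

-- Write L for the lag operator, (L z)ₙ = zₙ₋₁, and M = Σₜ Aₜ Lᵗ, a 2×2 matrix whose
-- entries are polynomials in L and hence commute.  The system says (I - M)(a, b)ᵀ = 0
-- from index s on.  Eliminating b, i.e. multiplying by the adjugate of I - M, gives
-- det(I - M) a = 0 from index 2s on, and likewise for b.  For 2×2 matrices
-- det(I - M) = 1 - (tr M - det M), so a = (tr M - det M) a, and the coefficients of
-- tr M - det M are the c⁽ˢ⁾: passing from s - 1 to s adds tr Aₛ Lˢ, the cross terms
-- 𝒟(A⁽ˡ'ˢ⁾) Lˢ⁺ˡ of the determinant, and |Aₛ| L²ˢ.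

open import Defs
open import Level using (Level)
open import Algebra.Bundles using (CommutativeRing)
open import Data.Nat using (ℕ; _≤_; _∸_)
open import Data.Product using (_×_; _,_)
import Data.Nat as N

open import Algebra.Solver.Ring.AlmostCommutativeRing
  using (fromCommutativeRing; _-Raw-AlmostCommutative⟶_; Induced-equivalence)
open import Data.Integer.Base as ℤ using (ℤ; +_; -[1+_])
import Data.Integer.Properties as ℤ
open import Data.Maybe.Base using (just; nothing)
open import Data.Nat using (zero; suc; _<_; _≟_; z≤n; s≤s)
import Data.Nat.Properties as NP
open import Data.Sign.Base as Sign using (Sign)
open import Data.Sum using (inj₁; inj₂)
open import Relation.Binary.Definitions using (WeaklyDecidable)
open import Relation.Binary.PropositionalEquality as ≡ using (_≡_; _≢_)
open import Relation.Nullary using (yes; no; contradiction)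

-- With the ring's own elements as coefficients (as in Tactic.RingSolver) the
-- normaliser cannot see that 1 - 1 = 0, so cancellations fail in an arbitrary
-- commutative ring; integer coefficients fix this.
module IntegerCoefficientSolver {c ℓ : Level} (R : CommutativeRing c ℓ) where
  open CommutativeRing R
  open import Algebra.Properties.Semiring.Mult semiring
    using (×-homo-+; ×1-homo-*) renaming (_×_ to _×ᵣ_)
  open import Algebra.Properties.Ring ring using (-0#≈0#; -1*x≈-x; -‿involutive; -‿+-comm)
  open import Algebra.Properties.CommutativeSemigroup *-commutativeSemigroup using (interchange)
  import Algebra.Properties.CommutativeSemigroup +-commutativeSemigroup as +-CS
  open import Relation.Binary.Reasoning.Setoid setoid

  ⟦_⟧ℤ : ℤ → Carrier
  ⟦ + n ⟧ℤ      = n ×ᵣ 1#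
  ⟦ -[1+ n ] ⟧ℤ = - (suc n ×ᵣ 1#)

  ⊖-homo : ∀ m n → ⟦ m ℤ.⊖ n ⟧ℤ ≈ m ×ᵣ 1# - n ×ᵣ 1#
  ⊖-homo m       zero    = sym (trans (+-congˡ -0#≈0#) (+-identityʳ _))
  ⊖-homo zero    (suc n) = sym (+-identityˡ _)
  ⊖-homo (suc m) (suc n) = begin
    ⟦ suc m ℤ.⊖ suc n ⟧ℤ               ≡⟨ ≡.cong ⟦_⟧ℤ (ℤ.[1+m]⊖[1+n]≡m⊖n m n) ⟩
    ⟦ m ℤ.⊖ n ⟧ℤ                       ≈⟨ ⊖-homo m n ⟩
    m ×ᵣ 1# - n ×ᵣ 1#                  ≈⟨ +-identityˡ _ ⟨
    0# + (m ×ᵣ 1# - n ×ᵣ 1#)           ≈⟨ +-congʳ (-‿inverseʳ 1#) ⟨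
    (1# - 1#) + (m ×ᵣ 1# - n ×ᵣ 1#)    ≈⟨ +-CS.interchange _ _ _ _ ⟩
    suc m ×ᵣ 1# + (- 1# - n ×ᵣ 1#)     ≈⟨ +-congˡ (-‿+-comm 1# _) ⟩
    suc m ×ᵣ 1# - suc n ×ᵣ 1#          ∎

  +-homo : ∀ i j → ⟦ i ℤ.+ j ⟧ℤ ≈ ⟦ i ⟧ℤ + ⟦ j ⟧ℤ
  +-homo (+ m)    (+ n)    = ×-homo-+ 1# m n
  +-homo (+ m)    -[1+ n ] = ⊖-homo m (suc n)
  +-homo -[1+ m ] (+ n)    = trans (⊖-homo n (suc m)) (+-comm _ _)
  +-homo -[1+ m ] -[1+ n ] = begin
    - (suc (suc (m N.+ n)) ×ᵣ 1#)      ≡⟨ ≡.cong (λ k → - (suc k ×ᵣ 1#)) (NP.+-suc m n) ⟨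
    - ((suc m N.+ suc n) ×ᵣ 1#)        ≈⟨ -‿cong (×-homo-+ 1# (suc m) (suc n)) ⟩
    - (suc m ×ᵣ 1# + suc n ×ᵣ 1#)      ≈⟨ -‿+-comm _ _ ⟨
    - (suc m ×ᵣ 1#) + - (suc n ×ᵣ 1#)  ∎

  -‿homo : ∀ i → ⟦ ℤ.- i ⟧ℤ ≈ - ⟦ i ⟧ℤ
  -‿homo (+ zero)  = sym -0#≈0#
  -‿homo (+ suc n) = refl
  -‿homo -[1+ n ]  = sym (-‿involutive _)

  ⟦_⟧ˢ : Sign → Carrier
  ⟦ Sign.+ ⟧ˢ = 1#
  ⟦ Sign.- ⟧ˢ = - 1#

  ◃-homo : ∀ s n → ⟦ s ℤ.◃ n ⟧ℤ ≈ ⟦ s ⟧ˢ * (n ×ᵣ 1#)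
  ◃-homo s      zero    = sym (zeroʳ _)
  ◃-homo Sign.+ (suc n) = sym (*-identityˡ _)
  ◃-homo Sign.- (suc n) = sym (-1*x≈-x _)

  sign-abs-homo : ∀ i → ⟦ i ⟧ℤ ≈ ⟦ ℤ.sign i ⟧ˢ * (ℤ.∣ i ∣ ×ᵣ 1#)
  sign-abs-homo (+ n)    = sym (*-identityˡ _)
  sign-abs-homo -[1+ n ] = sym (-1*x≈-x _)

  sign-*-homo : ∀ s t → ⟦ s Sign.* t ⟧ˢ ≈ ⟦ s ⟧ˢ * ⟦ t ⟧ˢ
  sign-*-homo Sign.+ t      = sym (*-identityˡ _)
  sign-*-homo Sign.- Sign.+ = sym (*-identityʳ _)
  sign-*-homo Sign.- Sign.- = sym (trans (-1*x≈-x _) (-‿involutive _))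

  *-homo : ∀ i j → ⟦ i ℤ.* j ⟧ℤ ≈ ⟦ i ⟧ℤ * ⟦ j ⟧ℤ
  *-homo i j = begin
    ⟦ ℤ.sign i Sign.* ℤ.sign j ℤ.◃ ℤ.∣ i ∣ N.* ℤ.∣ j ∣ ⟧ℤ
      ≈⟨ ◃-homo (ℤ.sign i Sign.* ℤ.sign j) (ℤ.∣ i ∣ N.* ℤ.∣ j ∣) ⟩
    ⟦ ℤ.sign i Sign.* ℤ.sign j ⟧ˢ * ((ℤ.∣ i ∣ N.* ℤ.∣ j ∣) ×ᵣ 1#)
      ≈⟨ *-cong (sign-*-homo (ℤ.sign i) (ℤ.sign j)) (×1-homo-* ℤ.∣ i ∣ ℤ.∣ j ∣) ⟩
    (⟦ ℤ.sign i ⟧ˢ * ⟦ ℤ.sign j ⟧ˢ) * ((ℤ.∣ i ∣ ×ᵣ 1#) * (ℤ.∣ j ∣ ×ᵣ 1#))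
      ≈⟨ interchange _ _ _ _ ⟩
    (⟦ ℤ.sign i ⟧ˢ * (ℤ.∣ i ∣ ×ᵣ 1#)) * (⟦ ℤ.sign j ⟧ˢ * (ℤ.∣ j ∣ ×ᵣ 1#))
      ≈⟨ *-cong (sign-abs-homo i) (sign-abs-homo j) ⟨
    ⟦ i ⟧ℤ * ⟦ j ⟧ℤ ∎

  morphism : ℤ.+-*-rawRing -Raw-AlmostCommutative⟶ fromCommutativeRing R
  morphism = record
    { ⟦_⟧    = ⟦_⟧ℤ
    ; +-homo = +-homo
    ; *-homo = *-homo
    ; -‿homo = -‿homo
    ; 0-homo = refl
    ; 1-homo = +-identityʳ 1#
    }

  _≟ℤ_ : WeaklyDecidable (Induced-equivalence morphism)
  i ≟ℤ j with i ℤ.≟ j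
  ... | yes i≡j = just (reflexive (≡.cong ⟦_⟧ℤ i≡j))
  ... | no  _   = nothing

  open import Algebra.Solver.Ring ℤ.+-*-rawRing (fromCommutativeRing R) morphism _≟ℤ_ public

n≤m⇒m+n≤2*m : ∀ {m n} → n ≤ m → m N.+ n ≤ 2 N.* m
n≤m⇒m+n≤2*m {m} n≤m = NP.+-monoʳ-≤ m (NP.≤-trans n≤m (NP.m≤m+n m 0))

m∸n∸o≡m∸[o+n] : ∀ m n o → m ∸ n ∸ o ≡ m ∸ (o N.+ n)
m∸n∸o≡m∸[o+n] m n o = ≡.trans (NP.∸-+-assoc m n o) (≡.cong (m ∸_) (NP.+-comm n o))

module SumProperties {c ℓ : Level} (R : CommutativeRing c ℓ) where
  open CommutativeRing R
  open IntegerCoefficientSolver R using (solve; _:=_; _:+_; _:-_; con)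
  open import Relation.Binary.Reasoning.Setoid setoid

  Σ1-cong-≤ : ∀ m {f g : ℕ → Carrier} → (∀ t → 1 ≤ t → t ≤ m → f t ≈ g t) →
              Σ1 R m f ≈ Σ1 R m g
  Σ1-cong-≤ zero    f≈g = refl
  Σ1-cong-≤ (suc m) f≈g = +-cong (Σ1-cong-≤ m (λ t 1≤t t≤m → f≈g t 1≤t (NP.m≤n⇒m≤1+n t≤m)))
                                 (f≈g (suc m) (s≤s z≤n) NP.≤-refl)

  Σ1-cong : ∀ m {f g : ℕ → Carrier} → (∀ t → f t ≈ g t) → Σ1 R m f ≈ Σ1 R m g
  Σ1-cong m f≈g = Σ1-cong-≤ m (λ t _ _ → f≈g t)

  Σ1-drop-zeros : ∀ {m} k (f : ℕ → Carrier) → m ≤ k → (∀ i → m < i → i ≤ k → f i ≈ 0#) →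
                  Σ1 R k f ≈ Σ1 R m f
  Σ1-drop-zeros zero          f z≤n   _   = refl
  Σ1-drop-zeros {m} (suc k) f m≤1+k f≈0 with NP.m≤n⇒m<n∨m≡n m≤1+k
  ... | inj₂ ≡.refl = refl
  ... | inj₁ m<1+k  = begin
    Σ1 R k f + f (suc k)  ≈⟨ +-cong (Σ1-drop-zeros k f (NP.≤-pred m<1+k) f≈0-below-k)
                                    (f≈0 (suc k) m<1+k NP.≤-refl) ⟩
    Σ1 R m f + 0#         ≈⟨ +-identityʳ _ ⟩
    Σ1 R m f              ∎
    where
    f≈0-below-k : ∀ i → m < i → i ≤ k → f i ≈ 0#
    f≈0-below-k i m<i i≤k = f≈0 i m<i (NP.m≤n⇒m≤1+n i≤k)

  Σ1-distrib-+ : ∀ m (f g : ℕ → Carrier) → Σ1 R m (λ t → f t + g t) ≈ Σ1 R m f + Σ1 R m g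
  Σ1-distrib-+ zero    f g = sym (+-identityˡ 0#)
  Σ1-distrib-+ (suc m) f g = trans (+-congʳ (Σ1-distrib-+ m f g))
    (solve 4 (λ F G x y → (F :+ G) :+ (x :+ y) := (F :+ x) :+ (G :+ y)) refl _ _ _ _)

  Σ1-distrib-sub : ∀ m (f g : ℕ → Carrier) → Σ1 R m (λ t → f t - g t) ≈ Σ1 R m f - Σ1 R m g
  Σ1-distrib-sub zero    f g = solve 0 (con (+ 0) := con (+ 0) :- con (+ 0)) refl
  Σ1-distrib-sub (suc m) f g = trans (+-congʳ (Σ1-distrib-sub m f g))
    (solve 4 (λ F G x y → (F :- G) :+ (x :- y) := (F :+ x) :- (G :+ y)) refl _ _ _ _)

  Σ1-distribˡ-* : ∀ m x (f : ℕ → Carrier) → x * Σ1 R m f ≈ Σ1 R m (λ t → x * f t)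
  Σ1-distribˡ-* zero    x f = zeroʳ x
  Σ1-distribˡ-* (suc m) x f = trans (distribˡ x _ _) (+-congʳ (Σ1-distribˡ-* m x f))

  Σ1-distribʳ-* : ∀ m x (f : ℕ → Carrier) → Σ1 R m f * x ≈ Σ1 R m (λ t → f t * x)
  Σ1-distribʳ-* m x f =
    trans (*-comm _ x) (trans (Σ1-distribˡ-* m x f) (Σ1-cong m (λ t → *-comm x (f t))))

  Σ1-comm : ∀ m k (f : ℕ → ℕ → Carrier) →
            Σ1 R m (λ t → Σ1 R k (f t)) ≈ Σ1 R k (λ u → Σ1 R m (λ t → f t u))
  Σ1-comm zero    k f = sym (Σ1-drop-zeros k _ z≤n (λ _ _ _ → refl))
  Σ1-comm (suc m) k f = trans (+-congʳ (Σ1-comm m k f)) (sym (Σ1-distrib-+ k _ _))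

  δ-refl : ∀ k x → δ R k k x ≈ x
  δ-refl k x with k ≟ k
  ... | yes _   = refl
  ... | no  k≢k = contradiction ≡.refl k≢k

  δ-≢ : ∀ {i k} x → i ≢ k → δ R i k x ≈ 0#
  δ-≢ {i} {k} x i≢k with i ≟ k
  ... | yes i≡k = contradiction i≡k i≢k
  ... | no  _   = refl

  Σ1-δ : ∀ m {k} x (g : ℕ → Carrier) → 1 ≤ k → k ≤ m → Σ1 R m (λ i → δ R i k x * g i) ≈ x * g k
  Σ1-δ zero    x g (s≤s _) ()
  Σ1-δ (suc m) {k} x g 1≤k k≤1+m with k ≟ suc m
  ... | yes ≡.refl = begin
    Σ1 R m (λ i → δ R i k x * g i) + δ R k k x * g k  ≈⟨ +-cong (Σ1-drop-zeros m _ z≤n below)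
                                                                (*-congʳ (δ-refl k x)) ⟩
    0# + x * g k                                      ≈⟨ +-identityˡ _ ⟩
    x * g k                                           ∎
    where
    below : ∀ i → 0 < i → i ≤ m → δ R i k x * g i ≈ 0#
    below i _ i≤m = trans (*-congʳ (δ-≢ x (NP.<⇒≢ (s≤s i≤m)))) (zeroˡ _)
  ... | no k≢1+m = begin
    Σ1 R m (λ i → δ R i k x * g i) + δ R (suc m) k x * g (suc m)
      ≈⟨ +-cong (Σ1-δ m x g 1≤k (NP.≤-pred (NP.≤∧≢⇒< k≤1+m k≢1+m)))
                (trans (*-congʳ (δ-≢ x (≡.≢-sym k≢1+m))) (zeroˡ _)) ⟩
    x * g k + 0#
      ≈⟨ +-identityʳ _ ⟩
    x * g k ∎

  Σ1-Σ1-δ : ∀ m s {k} (d g : ℕ → Carrier) → 1 ≤ k → k N.+ s ≤ m →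
            Σ1 R m (λ i → Σ1 R s (λ l → δ R i (k N.+ l) (d l)) * g i) ≈ Σ1 R s (λ l → d l * g (k N.+ l))
  Σ1-Σ1-δ m s {k} d g 1≤k k+s≤m = begin
    Σ1 R m (λ i → Σ1 R s (λ l → δ R i (k N.+ l) (d l)) * g i)  ≈⟨ Σ1-cong m (λ i → Σ1-distribʳ-* s (g i) _) ⟩
    Σ1 R m (λ i → Σ1 R s (λ l → δ R i (k N.+ l) (d l) * g i))  ≈⟨ Σ1-comm m s _ ⟩
    Σ1 R s (λ l → Σ1 R m (λ i → δ R i (k N.+ l) (d l) * g i))  ≈⟨ Σ1-cong-≤ s picked ⟩
    Σ1 R s (λ l → d l * g (k N.+ l))                           ∎
    where
    picked : ∀ l → 1 ≤ l → l ≤ s → Σ1 R m (λ i → δ R i (k N.+ l) (d l) * g i) ≈ d l * g (k N.+ l)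
    picked l _ l≤s = Σ1-δ m (d l) g (NP.≤-trans 1≤k (NP.m≤m+n k l)) (NP.≤-trans (NP.+-monoʳ-≤ k l≤s) k+s≤m)

module LagPolynomials {c ℓ : Level} (R : CommutativeRing c ℓ) where
  open CommutativeRing R
  open IntegerCoefficientSolver R using (solve; _:=_; _:+_; _:-_; _:*_)
  open SumProperties R
  open import Relation.Binary.Reasoning.Setoid setoid

  lag : ℕ → (ℕ → Carrier) → (ℕ → Carrier) → ℕ → Carrier
  lag s p x n = Σ1 R s (λ t → p t * x (n ∸ t))

  lag-comm : ∀ s p q x n → lag s p (lag s q x) n ≈ lag s q (lag s p x) n
  lag-comm s p q x n = begin
    Σ1 R s (λ t → p t * Σ1 R s (λ u → q u * x (n ∸ t ∸ u)))    ≈⟨ Σ1-cong s (λ t → Σ1-distribˡ-* s (p t) _) ⟩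
    Σ1 R s (λ t → Σ1 R s (λ u → p t * (q u * x (n ∸ t ∸ u))))  ≈⟨ Σ1-comm s s _ ⟩
    Σ1 R s (λ u → Σ1 R s (λ t → p t * (q u * x (n ∸ t ∸ u))))  ≈⟨ Σ1-cong s (λ u → Σ1-cong s (swap u)) ⟩
    Σ1 R s (λ u → Σ1 R s (λ t → q u * (p t * x (n ∸ u ∸ t))))  ≈⟨ Σ1-cong s (λ u → Σ1-distribˡ-* s (q u) _) ⟨
    Σ1 R s (λ u → q u * Σ1 R s (λ t → p t * x (n ∸ u ∸ t)))    ∎
    where
    swap : ∀ u t → p t * (q u * x (n ∸ t ∸ u)) ≈ q u * (p t * x (n ∸ u ∸ t))
    swap u t = begin
      p t * (q u * x (n ∸ t ∸ u))  ≡⟨ ≡.cong (λ k → p t * (q u * x k))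
                                       (≡.trans (m∸n∸o≡m∸[o+n] n t u) (≡.sym (NP.∸-+-assoc n u t))) ⟩
      p t * (q u * x (n ∸ u ∸ t))  ≈⟨ solve 3 (λ P Q X → P :* (Q :* X) := Q :* (P :* X)) refl _ _ _ ⟩
      q u * (p t * x (n ∸ u ∸ t))  ∎

  lag-distrib-+ : ∀ s p {x f g : ℕ → Carrier} n →
                  (∀ t → 1 ≤ t → t ≤ s → x (n ∸ t) ≈ f (n ∸ t) + g (n ∸ t)) →
                  lag s p x n ≈ lag s p f n + lag s p g n
  lag-distrib-+ s p n x≈f+g =
    trans (Σ1-cong-≤ s (λ t 1≤t t≤s → trans (*-congˡ (x≈f+g t 1≤t t≤s)) (distribˡ _ _ _)))
          (Σ1-distrib-+ s _ _)

  lag-lag-suc : ∀ s (p q x : ℕ → Carrier) n → let u = suc s; X k = x (n ∸ k) in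
    lag u q (lag u p x) n ≈
      (lag s q (lag s p x) n + Σ1 R s (λ l → (q l * p u + q u * p l) * X (u N.+ l))) + (q u * p u) * X (u N.+ u)
  lag-lag-suc s p q x n = begin
    Σ1 R s (λ t → q t * (lag s p x (n ∸ t) + p u * x (n ∸ t ∸ u)))
      + q u * (lag s p x (n ∸ u) + p u * x (n ∸ u ∸ u))
      ≈⟨ +-cong (trans (Σ1-cong s (λ t → distribˡ (q t) _ _)) (Σ1-distrib-+ s _ _)) (distribˡ (q u) _ _) ⟩
    (lag s q (lag s p x) n + Σ1 R s (λ t → q t * (p u * x (n ∸ t ∸ u))))
      + (q u * lag s p x (n ∸ u) + q u * (p u * x (n ∸ u ∸ u)))
      ≈⟨ +-cong (+-congˡ (Σ1-cong s late)) (+-cong (trans (Σ1-distribˡ-* s (q u) _) (Σ1-cong s early)) last) ⟩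
    (lag s q (lag s p x) n + Σ1 R s (λ l → (q l * p u) * X (u N.+ l)))
      + (Σ1 R s (λ l → (q u * p l) * X (u N.+ l)) + (q u * p u) * X (u N.+ u))
      ≈⟨ solve 4 (λ L S₁ S₂ T → (L :+ S₁) :+ (S₂ :+ T) := (L :+ (S₁ :+ S₂)) :+ T) refl _ _ _ _ ⟩
    (lag s q (lag s p x) n + (Σ1 R s (λ l → (q l * p u) * X (u N.+ l)) + Σ1 R s (λ l → (q u * p l) * X (u N.+ l))))
      + (q u * p u) * X (u N.+ u)
      ≈⟨ +-congʳ (+-congˡ (trans (Σ1-cong s (λ l → distribʳ _ _ _)) (Σ1-distrib-+ s _ _))) ⟨
    (lag s q (lag s p x) n + Σ1 R s (λ l → (q l * p u + q u * p l) * X (u N.+ l))) + (q u * p u) * X (u N.+ u)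
      ∎
    where
    u = suc s
    X : ℕ → Carrier
    X k = x (n ∸ k)
    reassoc : ∀ a b {y z} → y ≡ z → a * (b * x y) ≈ (a * b) * x z
    reassoc a b ≡.refl = sym (*-assoc a b _)
    late : ∀ t → q t * (p u * x (n ∸ t ∸ u)) ≈ (q t * p u) * X (u N.+ t)
    late t = reassoc (q t) (p u) (m∸n∸o≡m∸[o+n] n t u)
    early : ∀ l → q u * (p l * x (n ∸ u ∸ l)) ≈ (q u * p l) * X (u N.+ l)
    early l = reassoc (q u) (p l) (NP.∸-+-assoc n u l)
    last : q u * (p u * x (n ∸ u ∸ u)) ≈ (q u * p u) * X (u N.+ u)
    last = reassoc (q u) (p u) (NP.∸-+-assoc n u u)

  trMinusDetLag : ℕ → (p q r w x : ℕ → Carrier) → ℕ → Carrier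
  trMinusDetLag s p q r w x n =
    (lag s p x n + lag s w x n) - (lag s w (lag s p x) n - lag s q (lag s r x) n)

  trMinusDetLag-swap : ∀ s p q r w x n → trMinusDetLag s w r q p x n ≈ trMinusDetLag s p q r w x n
  trMinusDetLag-swap s p q r w x n =
    +-cong (+-comm _ _) (-‿cong (+-cong (lag-comm s p w x n) (-‿cong (lag-comm s r q x n))))

  trMinusDetLag-elimination : ∀ s p q r w {x y : ℕ → Carrier} →
    (∀ m → s ≤ m → x m ≈ lag s p x m + lag s q y m) →
    (∀ m → s ≤ m → y m ≈ lag s r x m + lag s w y m) →
    ∀ n → 2 N.* s ≤ n → x n ≈ trMinusDetLag s p q r w x n
  trMinusDetLag-elimination s p q r w {x} {y} x-rec y-rec n 2s≤n = begin
    x n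
      ≈⟨ x-rec n (NP.≤-trans (NP.m≤m+n s _) 2s≤n) ⟩
    lag s p x n + lag s q y n
      ≈⟨ +-congˡ (lag-distrib-+ s q {y} {lag s r x} {lag s w y} n (λ t _ t≤s → y-rec (n ∸ t) (window t≤s))) ⟩
    lag s p x n + (lag s q (lag s r x) n + lag s q (lag s w y) n)
      ≈⟨ +-congˡ (+-congˡ (lag-comm s q w y n)) ⟩
    lag s p x n + (lag s q (lag s r x) n + lag s w (lag s q y) n)
      ≈⟨ solve 4 (λ P QR WP WQ → P :+ (QR :+ WQ) := (P :+ (WP :+ WQ)) :- (WP :- QR)) refl _ _ _ _ ⟩
    (lag s p x n + (lag s w (lag s p x) n + lag s w (lag s q y) n))
      - (lag s w (lag s p x) n - lag s q (lag s r x) n)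
      ≈⟨ +-congʳ (+-congˡ (lag-distrib-+ s w {x} {lag s p x} {lag s q y} n
                             (λ t _ t≤s → x-rec (n ∸ t) (window t≤s)))) ⟨
    trMinusDetLag s p q r w x n
      ∎
    where
    window : ∀ {t} → t ≤ s → s ≤ n ∸ t
    window t≤s = NP.m+n≤o⇒m≤o∸n s (NP.≤-trans (NP.+-monoʳ-≤ s (NP.≤-trans t≤s (NP.m≤m+n s 0))) 2s≤n)

  trMinusDetLag-suc : ∀ s (p q r w x : ℕ → Carrier) n → let u = suc s; X k = x (n ∸ k) in
    trMinusDetLag u p q r w x n ≈
      ((trMinusDetLag s p q r w x n + (p u + w u) * X u)
        - Σ1 R s (λ l → ((p l * w u - q u * r l) + (p u * w l - q l * r u)) * X (u N.+ l)))
        - (p u * w u - q u * r u) * X (u N.+ u)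
  trMinusDetLag-suc s p q r w x n = begin
    ((lag s p x n + p u * X u) + (lag s w x n + w u * X u))
      - (lag u w (lag u p x) n - lag u q (lag u r x) n)
      ≈⟨ +-congˡ (-‿cong (+-cong (lag-lag-suc s p w x n) (-‿cong (lag-lag-suc s r q x n)))) ⟩
    ((lag s p x n + p u * X u) + (lag s w x n + w u * X u))
      - (((lag s w (lag s p x) n + Σwp) + (w u * p u) * X (u N.+ u))
         - ((lag s q (lag s r x) n + Σqr) + (q u * r u) * X (u N.+ u)))
      ≈⟨ solve 12 (λ P W WP QR Σ₁ Σ₂ pᵤ wᵤ qᵤ rᵤ Xᵤ X₂ᵤ →
           ((P :+ pᵤ :* Xᵤ) :+ (W :+ wᵤ :* Xᵤ))
             :- (((WP :+ Σ₁) :+ (wᵤ :* pᵤ) :* X₂ᵤ) :- ((QR :+ Σ₂) :+ (qᵤ :* rᵤ) :* X₂ᵤ))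
           := ((((P :+ W) :- (WP :- QR)) :+ (pᵤ :+ wᵤ) :* Xᵤ) :- (Σ₁ :- Σ₂)) :- (pᵤ :* wᵤ :- qᵤ :* rᵤ) :* X₂ᵤ)
           refl _ _ _ _ _ _ _ _ _ _ _ _ ⟩
    ((trMinusDetLag s p q r w x n + (p u + w u) * X u) - (Σwp - Σqr)) - (p u * w u - q u * r u) * X (u N.+ u)
      ≈⟨ +-congʳ (+-congˡ (-‿cong mixed-split)) ⟨
    ((trMinusDetLag s p q r w x n + (p u + w u) * X u)
      - Σ1 R s (λ l → ((p l * w u - q u * r l) + (p u * w l - q l * r u)) * X (u N.+ l)))
      - (p u * w u - q u * r u) * X (u N.+ u)
      ∎
    where
    u = suc s
    X : ℕ → Carrier
    X k = x (n ∸ k)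
    Σwp Σqr : Carrier
    Σwp = Σ1 R s (λ l → (w l * p u + w u * p l) * X (u N.+ l))
    Σqr = Σ1 R s (λ l → (q l * r u + q u * r l) * X (u N.+ l))
    mixed-split : Σ1 R s (λ l → ((p l * w u - q u * r l) + (p u * w l - q l * r u)) * X (u N.+ l)) ≈ Σwp - Σqr
    mixed-split = trans
      (Σ1-cong s (λ l → solve 9 (λ pₗ pᵤ qₗ qᵤ rₗ rᵤ wₗ wᵤ Y →
         ((pₗ :* wᵤ :- qᵤ :* rₗ) :+ (pᵤ :* wₗ :- qₗ :* rᵤ)) :* Y
         := (wₗ :* pᵤ :+ wᵤ :* pₗ) :* Y :- (qₗ :* rᵤ :+ qᵤ :* rₗ) :* Y)
         refl (p l) (p u) (q l) (q u) (r l) (r u) (w l) (w u) (X (u N.+ l))))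
      (Σ1-distrib-sub s _ _)

module Coefficients {c ℓ : Level} (R : CommutativeRing c ℓ) (A : ℕ → Mat2 R) where
  open CommutativeRing R
  open IntegerCoefficientSolver R using (solve; _:=_; _:+_; _:-_; _:*_; con)
  open SumProperties R
  open LagPolynomials R
  open import Relation.Binary.Reasoning.Setoid setoid

  α₁₁ α₁₂ α₂₁ α₂₂ : ℕ → Carrier
  α₁₁ t = m11 (A t)
  α₁₂ t = m12 (A t)
  α₂₁ t = m21 (A t)
  α₂₂ t = m22 (A t)

  coef-vanishes : ∀ r {i} → 2 N.* r < i → coef R A r i ≈ 0#
  coef-vanishes zero    _ = refl
  coef-vanishes (suc r) {i} 2u<i = begin
    ((coef R A r i + δ R i u (tr R (A u))) - Σ1 R r (λ l → δ R i (u N.+ l) (𝒟 R A l u)))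
      - δ R i (u N.+ u) (det R (A u))
      ≈⟨ +-cong (+-cong (+-cong (coef-vanishes r 2r<i) (beyond (NP.m≤m+n u _)))
                        (-‿cong (Σ1-drop-zeros r _ z≤n
                                  (λ l _ l≤r → beyond (n≤m⇒m+n≤2*m (NP.m≤n⇒m≤1+n l≤r))))))
                (-‿cong (beyond (n≤m⇒m+n≤2*m {u} NP.≤-refl))) ⟩
    ((0# + 0#) - 0#) - 0#
      ≈⟨ solve 0 (((con (+ 0) :+ con (+ 0)) :- con (+ 0)) :- con (+ 0) := con (+ 0)) refl ⟩
    0# ∎
    where
    u = suc r
    beyond : ∀ {k} {y} → k ≤ 2 N.* u → δ R i k y ≈ 0#
    beyond k≤2u = δ-≢ _ (NP.>⇒≢ (NP.≤-<-trans k≤2u 2u<i))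
    2r<i : 2 N.* r < i
    2r<i = NP.≤-<-trans (NP.*-monoʳ-≤ 2 (NP.n≤1+n r)) 2u<i

  coef-expansion : ∀ s x n →
    Σ1 R (2 N.* s) (λ i → coef R A s i * x (n ∸ i)) ≈ trMinusDetLag s α₁₁ α₁₂ α₂₁ α₂₂ x n
  coef-expansion zero    x n =
    solve 0 (con (+ 0) := (con (+ 0) :+ con (+ 0)) :- (con (+ 0) :- con (+ 0))) refl
  coef-expansion (suc s) x n = begin
    Σ1 R (2 N.* u) (λ i → coef R A u i * X i)
      ≈⟨ Σ1-cong (2 N.* u) (λ i → solve 5 (λ C T D E Y →
           (((C :+ T) :- D) :- E) :* Y := ((C :* Y :+ T :* Y) :- D :* Y) :- E :* Y) refl _ _ _ _ _) ⟩
    Σ1 R (2 N.* u) (λ i → ((coef R A s i * X i + δ R i u (tr R (A u)) * X i) - mixed i * X i)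
                          - δ R i (u N.+ u) (det R (A u)) * X i)
      ≈⟨ trans (Σ1-distrib-sub (2 N.* u) _ _)
               (+-congʳ (trans (Σ1-distrib-sub (2 N.* u) _ _) (+-congʳ (Σ1-distrib-+ (2 N.* u) _ _)))) ⟩
    ((Σ1 R (2 N.* u) (λ i → coef R A s i * X i) + Σ1 R (2 N.* u) (λ i → δ R i u (tr R (A u)) * X i))
      - Σ1 R (2 N.* u) (λ i → mixed i * X i)) - Σ1 R (2 N.* u) (λ i → δ R i (u N.+ u) (det R (A u)) * X i)
      ≈⟨ +-cong (+-cong (+-cong shrink (Σ1-δ (2 N.* u) (tr R (A u)) X (s≤s z≤n) (NP.m≤m+n u _)))
                        (-‿cong (Σ1-Σ1-δ (2 N.* u) s (λ l → 𝒟 R A l u) X (s≤s z≤n) (n≤m⇒m+n≤2*m (NP.n≤1+n s)))))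
                (-‿cong (Σ1-δ (2 N.* u) (det R (A u)) X (s≤s z≤n) (n≤m⇒m+n≤2*m {u} NP.≤-refl))) ⟩
    ((Σ1 R (2 N.* s) (λ i → coef R A s i * X i) + tr R (A u) * X u) - Σ1 R s (λ l → 𝒟 R A l u * X (u N.+ l)))
      - det R (A u) * X (u N.+ u)
      ≈⟨ +-congʳ (+-congʳ (+-congʳ (coef-expansion s x n))) ⟩
    ((trMinusDetLag s α₁₁ α₁₂ α₂₁ α₂₂ x n + tr R (A u) * X u) - Σ1 R s (λ l → 𝒟 R A l u * X (u N.+ l)))
      - det R (A u) * X (u N.+ u)
      ≈⟨ trMinusDetLag-suc s α₁₁ α₁₂ α₂₁ α₂₂ x n ⟨
    trMinusDetLag u α₁₁ α₁₂ α₂₁ α₂₂ x n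
      ∎
    where
    u = suc s
    X : ℕ → Carrier
    X k = x (n ∸ k)
    mixed : ℕ → Carrier
    mixed i = Σ1 R s (λ l → δ R i (u N.+ l) (𝒟 R A l u))
    shrink : Σ1 R (2 N.* u) (λ i → coef R A s i * X i) ≈ Σ1 R (2 N.* s) (λ i → coef R A s i * X i)
    shrink = Σ1-drop-zeros (2 N.* u) _ (NP.*-monoʳ-≤ 2 (NP.n≤1+n s))
               (λ i 2s<i _ → trans (*-congʳ (coef-vanishes s 2s<i)) (zeroˡ _))

theorem1 : {c ℓ : Level} (R : CommutativeRing c ℓ) →
    let open CommutativeRing R in
    (s : ℕ) → 1 ≤ s →
    (A : ℕ → Mat2 R) → (a b : ℕ → Carrier) →
    (∀ n → s ≤ n →
      a n ≈ Σ1 R s (λ t → m11 (A t) * a (n ∸ t) + m12 (A t) * b (n ∸ t))) →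
    (∀ n → s ≤ n →
      b n ≈ Σ1 R s (λ t → m21 (A t) * a (n ∸ t) + m22 (A t) * b (n ∸ t))) →
    (∀ n → 2 N.* s ≤ n → a n ≈ Σ1 R (2 N.* s) (λ i → coef R A s i * a (n ∸ i)))
      × (∀ n → 2 N.* s ≤ n → b n ≈ Σ1 R (2 N.* s) (λ i → coef R A s i * b (n ∸ i)))
theorem1 R s _ A a b a-rec b-rec = a-rec′ , b-rec′
  where
  open CommutativeRing R
  open import Relation.Binary.Reasoning.Setoid setoid
  open SumProperties R using (Σ1-distrib-+)
  open LagPolynomials R
  open Coefficients R A
  a-lag : ∀ m → s ≤ m → a m ≈ lag s α₁₁ a m + lag s α₁₂ b m
  a-lag m s≤m = trans (a-rec m s≤m) (Σ1-distrib-+ s _ _)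
  b-lag : ∀ m → s ≤ m → b m ≈ lag s α₂₁ a m + lag s α₂₂ b m
  b-lag m s≤m = trans (b-rec m s≤m) (Σ1-distrib-+ s _ _)
  a-rec′ : ∀ n → 2 N.* s ≤ n → a n ≈ Σ1 R (2 N.* s) (λ i → coef R A s i * a (n ∸ i))
  a-rec′ n 2s≤n = begin
    a n                                  ≈⟨ trMinusDetLag-elimination s α₁₁ α₁₂ α₂₁ α₂₂ a-lag b-lag n 2s≤n ⟩
    trMinusDetLag s α₁₁ α₁₂ α₂₁ α₂₂ a n  ≈⟨ coef-expansion s a n ⟨
    Σ1 R (2 N.* s) (λ i → coef R A s i * a (n ∸ i)) ∎
  b-rec′ : ∀ n → 2 N.* s ≤ n → b n ≈ Σ1 R (2 N.* s) (λ i → coef R A s i * b (n ∸ i))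
  b-rec′ n 2s≤n = begin
    b n                                  ≈⟨ trMinusDetLag-elimination s α₂₂ α₂₁ α₁₂ α₁₁
                                              (λ m s≤m → trans (b-lag m s≤m) (+-comm _ _))
                                              (λ m s≤m → trans (a-lag m s≤m) (+-comm _ _)) n 2s≤n ⟩
    trMinusDetLag s α₂₂ α₂₁ α₁₂ α₁₁ b n  ≈⟨ trMinusDetLag-swap s α₁₁ α₁₂ α₂₁ α₂₂ b n ⟩
    trMinusDetLag s α₁₁ α₁₂ α₂₁ α₂₂ b n  ≈⟨ coef-expansion s b n ⟨
    Σ1 R (2 N.* s) (λ i → coef R A s i * b (n ∸ i)) ∎
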